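{- For every integer $p$ with $4\le p\le 13$ and every positive integer $m$, the $m$-th line digraph $L^m(C_3\cdot C_p)$ is a DNA graph.
   Context: All digraphs are finite. For an arc $a=uv$, $u$ is its tail and $v$ its head. The line digraph $L(D)$ has vertex set $A(D)$, with an arc $xy$ iff the head of $x$ equals the tail of $y$; $L^1(D)=L(D)$, $L^{m+1}(D)=L(L^m(D))$. For integers $\alpha>0$, $k>1$, an $(\alpha,k)$-labeling of $D=(V,A)$ assigns to each vertex $x$ a string $(l_1(x),\dots,l_k(x))$ with entries in $\{1,\dots,\alpha\}$, distinct vertices getting distinct strings, such that for all vertices $x,y$: $xy\in A$ iff $l_i(x)=l_{i-1}(y)$ for all $i\in\{2,\dots,k\}$. A DNA graph is a digraph admitting a $(4,k)$-labeling for some integer $k>1$. The $\infty$-digraph $C_n\cdot C_p$ is obtained from a directed cycle of length $n$ and a directed cycle of length $p$, otherwise vertex-disjoint, by identifying one vertex of the first with one vertex of the second. -}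

module Defs where

open import Data.Nat using (ℕ; zero; suc; _+_; _∸_; _<_; _≡ᵇ_; _<ᵇ_; _≤ᵇ_)
open import Data.Bool using (Bool; true; false; T; _∧_; _∨_)
open import Data.Bool.Properties using (T-irrelevant)
open import Data.Fin using (Fin; toℕ; inject₁)
import Data.Fin.Properties as FinP
open import Data.Vec using (Vec; lookup)
open import Data.Product using (Σ; _×_; _,_; proj₁; proj₂; ∃)
open import Function using (_∘_; _⇔_)
open import Function.Definitions using (Injective)
open import Relation.Binary.PropositionalEquality using (_≡_; refl; cong)
open import Relation.Binary.Definitions using (DecidableEquality)
open import Relation.Nullary using (yes; no; ⌊_⌋)

-- A digraph: a vertex type with decidable equality and a Bool-valued
-- arc relation (so there are no multiple arcs).
record Digraph : Set₁ where
  field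
    V    : Set
    _≟_  : DecidableEquality V
    adj  : V → V → Bool

open Digraph public

Arc : Digraph → Set
Arc D = Σ (V D × V D) (λ uv → T (adj D (proj₁ uv) (proj₂ uv)))

tail : (D : Digraph) → Arc D → V D
tail D a = proj₁ (proj₁ a)

head : (D : Digraph) → Arc D → V D
head D a = proj₂ (proj₁ a)

arc-≟ : (D : Digraph) → DecidableEquality (Arc D)
arc-≟ D ((u , v) , p) ((u' , v') , q) with _≟_ D u u' | _≟_ D v v'
... | yes refl | yes refl = yes (cong ((u , v) ,_) (T-irrelevant p q))
... | no ne    | _        = no (λ eq → ne (cong (proj₁ ∘ proj₁) eq))
... | yes _    | no ne    = no (λ eq → ne (cong (proj₂ ∘ proj₁) eq))

L : Digraph → Digraph
L D = record
  { V   = Arc D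
  ; _≟_ = arc-≟ D
  ; adj = λ x y → ⌊ _≟_ D (head D x) (tail D y) ⌋
  }

L^ : ℕ → Digraph → Digraph
L^ zero    D = D
L^ (suc m) D = L (L^ m D)

-- An (α , k)-labeling for k = suc k' (entries in Fin α ≅ {1..α}).
-- Entry i (1-indexed i ∈ {2..k}) is index suc i' (i' : Fin k'),
-- entry i-1 is inject₁ i'.
record Labeling (α k' : ℕ) (D : Digraph) : Set where
  field
    label     : V D → Vec (Fin α) (suc k')
    injective : Injective _≡_ _≡_ label
    adjacency : ∀ x y →
      T (adj D x y) ⇔
      (∀ (i : Fin k') → lookup (label x) (Fin.suc i) ≡ lookup (label y) (inject₁ i))

-- DNA graph: admits a (4 , k)-labeling for some k > 1, i.e. k = suc k' with k' ≥ 1.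
IsDNAGraph : Digraph → Set
IsDNAGraph D = Σ ℕ (λ k' → (1 Data.Nat.≤ k') × Labeling 4 k' D)

-- The ∞-digraph C_n · C_p on vertex set Fin (n + p ∸ 1) (intended n , p ≥ 2):
-- shared vertex 0; first cycle 0 → 1 → … → n-1 → 0;
-- second cycle 0 → n → n+1 → … → n+p-2 → 0.
infAdj : (n p : ℕ) → ℕ → ℕ → Bool
infAdj n p a b =
     ((suc a ≡ᵇ b) ∧ (b <ᵇ n))
  ∨ ((a ≡ᵇ (n ∸ 1)) ∧ (b ≡ᵇ 0))
  ∨ ((a ≡ᵇ 0) ∧ (b ≡ᵇ n))
  ∨ ((n ≤ᵇ a) ∧ (suc a ≡ᵇ b))
  ∨ ((a ≡ᵇ (n + p ∸ 2)) ∧ (b ≡ᵇ 0))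

InfDigraph : ℕ → ℕ → Digraph
InfDigraph n p = record
  { V   = Fin (n + p ∸ 1)
  ; _≟_ = FinP._≟_
  ; adj = λ i j → infAdj n p (toℕ i) (toℕ j)
  }

-- (1) Line digraphs preserve labelings: if D has an (α, k)-labeling ℓ, then
--     labelling the arc xy of D by the string ℓ(x)₁ ∷ ℓ(y) gives an
--     (α, k+1)-labeling of L(D).  The only fact about strings this needs is
--     that a string u is determined by its first letter together with the
--     condition "the last k-1 letters of u start the string w" (for a fixed
--     successor string w).  Iterating, L^m(D) is a DNA graph whenever D is.
--
-- (2) C₃·C_p itself has a (4, 3)-labeling for 4 ≤ p ≤ 13.  Each labeling is
--     given by two cyclic words over {a, c, g, t}, one per cycle, both starting
--     with the same window: a vertex is labelled by the length-3 window of its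
--     cycle's word starting at its position.  Being a labeling is decidable on
--     a digraph with a finite vertex set, and the ten candidates are verified
--     by one evaluation of this decision procedure.
module Submission where

open import Defs
open import Data.Bool using (T; if_then_else_)
open import Data.Bool.Properties using (T?; T-irrelevant)
open import Data.Fin using (Fin; zero; suc; toℕ; inject₁; #_)
import Data.Fin.Properties as FinP
open import Data.Nat using (ℕ; zero; suc; _+_; _∸_; _≤_; _<_; _<ᵇ_; _≤?_; s≤s; z≤n)
open import Data.Nat.DivMod using (_mod_)
open import Data.Nat.Properties using (≤-trans; m≤n+m; allUpTo?)
open import Data.Product using (_×_; _,_)
open import Data.Vec using (Vec; lookup; tabulate; _∷_; [])
open import Data.Vec.Properties using (∷-injectiveˡ; ∷-injectiveʳ; ≡-dec)
open import Data.Vec.Relation.Binary.Pointwise.Extensional using (ext; Pointwise-≡⇒≡)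
open import Function using (_⇔_; Equivalence)
open import Function.Bundles using (mk⇔)
import Function.Properties.Equivalence as ⇔
open import Relation.Binary.Definitions using (DecidableEquality)
open import Relation.Binary.PropositionalEquality using (_≡_; refl; cong; sym; trans)
open import Relation.Nullary using (Dec)
open import Relation.Nullary.Decidable
  using (map′; toWitness; fromWitness; _→-dec_; _×-dec_)
open import Relation.Unary using (Decidable)

open Equivalence using (to; from)

_⇝_ : ∀ {A : Set} {k} → Vec A (suc k) → Vec A (suc k) → Set
u ⇝ v = ∀ i → lookup u (suc i) ≡ lookup v (inject₁ i)

⇝-dec : ∀ {A : Set} {k} → DecidableEquality A → (u v : Vec A (suc k)) → Dec (u ⇝ v)
⇝-dec _≟_ u v = FinP.all? λ i → lookup u (suc i) ≟ lookup v (inject₁ i)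

cons-⇝ : ∀ {A : Set} {k} {a b : A} (u w : Vec A (suc k)) →
         (a ∷ u) ⇝ (b ∷ w) ⇔ (lookup u zero ≡ b × u ⇝ w)
cons-⇝ u w = mk⇔ (λ h → h zero , λ i → h (suc i))
                 (λ { (e , h) zero → e ; (e , h) (suc i) → h i })

determined-by-first-letter : ∀ {A : Set} {k} {u v : Vec A (suc k)} w → v ⇝ w →
  u ≡ v ⇔ (lookup u zero ≡ lookup v zero × u ⇝ w)
determined-by-first-letter {u = u} {v} w v⇝w = mk⇔ necessary sufficient
  where
  necessary : u ≡ v → lookup u zero ≡ lookup v zero × u ⇝ w
  necessary refl = refl , v⇝w

  sufficient : lookup u zero ≡ lookup v zero × u ⇝ w → u ≡ v
  sufficient (e , u⇝w) = Pointwise-≡⇒≡ (ext agree)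
    where
    agree : ∀ i → lookup u i ≡ lookup v i
    agree zero    = e
    agree (suc i) = trans (u⇝w i) (sym (v⇝w i))

arc-≡ : ∀ {D : Digraph} {a b : Arc D} → tail D a ≡ tail D b → head D a ≡ head D b → a ≡ b
arc-≡ {a = (x , y) , p} {(.x , .y) , q} refl refl = cong ((x , y) ,_) (T-irrelevant p q)

lineLabeling : ∀ {α k D} → Labeling α k D → Labeling α (suc k) (L D)
lineLabeling {α} {k} {D} ℓ = record
  { label = arcLabel ; injective = arcLabel-injective ; adjacency = arcAdjacency }
  where
  open Labeling ℓ

  arcLabel : Arc D → Vec (Fin α) (suc (suc k))
  arcLabel ((x , y) , _) = lookup (label x) zero ∷ label y

  arcLabel-injective : ∀ {a b} → arcLabel a ≡ arcLabel b → a ≡ b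
  arcLabel-injective {(x , y) , xy} {(x′ , y′) , x′y′} e
    with injective (∷-injectiveʳ e)
  ... | refl = arc-≡ {D} (injective (from (determined-by-first-letter (label y) x′⇝y)
                            (∷-injectiveˡ e , to (adjacency x y) xy))) refl
    where x′⇝y = to (adjacency x′ y) x′y′

  -- xy → y′z in L(D)  ⇔  y ≡ y′  ⇔  label y ≡ label y′  ⇔  arcLabel xy ⇝ arcLabel y′z.
  arcAdjacency : ∀ a b → T (adj (L D) a b) ⇔ arcLabel a ⇝ arcLabel b
  arcAdjacency ((x , y) , _) ((y′ , z) , y′z) =
    ⇔.trans (mk⇔ toWitness fromWitness)
   (⇔.trans (mk⇔ (cong label) injective)
   (⇔.trans (determined-by-first-letter (label z) (to (adjacency y′ z) y′z))
            (⇔.sym (cons-⇝ {a = lookup (label x) zero} (label y) (label z)))))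

iteratedLineLabeling : ∀ {α k D} m → Labeling α k D → Labeling α (m + k) (L^ m D)
iteratedLineLabeling zero    ℓ = ℓ
iteratedLineLabeling (suc m) ℓ = lineLabeling (iteratedLineLabeling m ℓ)

L^-preserves-DNA : ∀ m {D} → IsDNAGraph D → IsDNAGraph (L^ m D)
L^-preserves-DNA m (k , 1≤k , ℓ) =
  m + k , ≤-trans 1≤k (m≤n+m k m) , iteratedLineLabeling m ℓ

_⇔-dec_ : ∀ {P Q : Set} → Dec P → Dec Q → Dec (P ⇔ Q)
P? ⇔-dec Q? =
  map′ (λ (to , from) → mk⇔ to from) (λ e → to e , from e) ((P? →-dec Q?) ×-dec (Q? →-dec P?))

module Certificate {α k : ℕ} (D : Digraph)
  (∀? : ∀ {P : V D → Set} → Decidable P → Dec (∀ x → P x)) where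

  IsLabeling : (V D → Vec (Fin α) (suc k)) → Set
  IsLabeling f = (∀ x y → f x ≡ f y → x ≡ y) × (∀ x y → T (adj D x y) ⇔ f x ⇝ f y)

  toLabeling : ∀ {f} → IsLabeling f → Labeling α k D
  toLabeling {f} (inj , adjacency) = record
    { label = f ; injective = λ {x} {y} → inj x y ; adjacency = adjacency }

  isLabeling? : ∀ f → Dec (IsLabeling f)
  isLabeling? f = (∀? λ x → ∀? λ y → ≡-dec FinP._≟_ (f x) (f y) →-dec (_≟_ D x y))
           ×-dec (∀? λ x → ∀? λ y → T? (adj D x y) ⇔-dec ⇝-dec FinP._≟_ (f x) (f y))

a c g t : Fin 4
a = # 0
c = # 1
g = # 2
t = # 3

window : ∀ {X : Set} {n} k → Vec X (suc n) → ℕ → Vec X k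
window {n = n} k w j = tabulate λ i → lookup w ((j + toℕ i) mod suc n)

-- Window labels of C_n·C_p from a word u around the first cycle and a word w
-- around the second: vertex i < n sits at position i of the first cycle, vertex
-- i ≥ n at position i+1-n of the second (vertex 0 lies on both, so u and w
-- must share their first window).
cycleWindows : ∀ {X : Set} {n p} k → Vec X (suc n) → Vec X (suc p) →
               Fin (suc n + suc p ∸ 1) → Vec X k
cycleWindows {n = n} k u w x =
  if toℕ x <ᵇ suc n then window k u (toℕ x) else window k w (toℕ x + 1 ∸ suc n)

-- The (4, 3)-labelings of C₃·C_p for 4 ≤ p ≤ 13 (irrelevant outside this range).
labelsOf : (p : ℕ) → V (InfDigraph 3 p) → Vec (Fin 4) 3
labelsOf 4  = cycleWindows 3 (a ∷ a ∷ c ∷ []) (a ∷ a ∷ c ∷ g ∷ [])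
labelsOf 5  = cycleWindows 3 (a ∷ a ∷ c ∷ []) (a ∷ a ∷ c ∷ c ∷ g ∷ [])
labelsOf 6  = cycleWindows 3 (a ∷ a ∷ c ∷ []) (a ∷ a ∷ c ∷ c ∷ g ∷ g ∷ [])
labelsOf 7  = cycleWindows 3 (a ∷ a ∷ c ∷ []) (a ∷ a ∷ c ∷ c ∷ g ∷ a ∷ t ∷ [])
labelsOf 8  = cycleWindows 3 (a ∷ a ∷ c ∷ []) (a ∷ a ∷ c ∷ c ∷ g ∷ a ∷ g ∷ t ∷ [])
labelsOf 9  = cycleWindows 3 (a ∷ a ∷ c ∷ []) (a ∷ a ∷ c ∷ c ∷ g ∷ a ∷ g ∷ c ∷ t ∷ [])
labelsOf 10 = cycleWindows 3 (a ∷ a ∷ c ∷ []) (a ∷ a ∷ c ∷ c ∷ g ∷ a ∷ g ∷ c ∷ t ∷ t ∷ [])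
labelsOf 11 = cycleWindows 3 (a ∷ a ∷ c ∷ []) (a ∷ a ∷ c ∷ c ∷ g ∷ a ∷ g ∷ c ∷ t ∷ g ∷ t ∷ [])
labelsOf 12 = cycleWindows 3 (a ∷ a ∷ c ∷ []) (a ∷ a ∷ c ∷ c ∷ g ∷ a ∷ g ∷ c ∷ t ∷ g ∷ g ∷ t ∷ [])
labelsOf 13 = cycleWindows 3 (a ∷ a ∷ c ∷ []) (a ∷ a ∷ c ∷ c ∷ g ∷ a ∷ g ∷ c ∷ t ∷ g ∷ g ∷ t ∷ t ∷ [])
labelsOf _  = λ _ → a ∷ a ∷ a ∷ []

module ∞-Certificate (p : ℕ) = Certificate {4} {2} (InfDigraph 3 p) FinP.all?

labelsOf-isLabeling : ∀ {p} → p < 14 → 4 ≤ p → ∞-Certificate.IsLabeling p (labelsOf p)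
labelsOf-isLabeling =
  toWitness {a? = allUpTo? (λ p → 4 ≤? p →-dec ∞-Certificate.isLabeling? p (labelsOf p)) 14} _

C₃·C_p-isDNA : ∀ p → 4 ≤ p → p ≤ 13 → IsDNAGraph (InfDigraph 3 p)
C₃·C_p-isDNA p 4≤p p≤13 =
  2 , s≤s z≤n , ∞-Certificate.toLabeling p (labelsOf-isLabeling (s≤s p≤13) 4≤p)

-- The theorem.

theorem7 : (p : ℕ) → 4 ≤ p → p ≤ 13 → (m : ℕ) → 1 ≤ m → IsDNAGraph (L^ m (InfDigraph 3 p))
theorem7 p 4≤p p≤13 m _ = L^-preserves-DNA m (C₃·C_p-isDNA p 4≤p p≤13)
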